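{- Let $E$ be an ordinary elliptic curve over $\mathbb{F}_q$ ($q$ a power of a prime $p\ge5$) with $\operatorname{End}(E)=\mathcal{O}$, an order in an imaginary quadratic field $K$ with conductor $f$, $j(E)\notin\{0,1728\}$, and let $N$ be a positive integer coprime to $p$ and $f$. Identify $E[N]$ with $\mathcal{O}/N\mathcal{O}$ as $\mathcal{O}/N\mathcal{O}$-modules. Let $P\in\mathcal{O}/N\mathcal{O}$ have (additive) order $N$ (i.e. correspond to a $\Gamma_1(N)$-level structure), and let $\mathfrak{a}=\langle P,N\mathcal{O}\rangle$ be the $\mathcal{O}$-ideal generated by (a lift of) $P$ and $N$. Then \[\operatorname{Stab}(P)=\left\{\alpha\in(\mathcal{O}/N\mathcal{O})^{\times}\;\middle|\;\alpha\equiv\pm1 \bmod \mathfrak{a}^{ -1}N\mathcal{O}\right\}.\]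
   Context: A $\Gamma_1(N)$-level structure on $E$ is a point of $E[N]$ of order $N$. Pairs $(E,\gamma)$, $(E',\gamma')$ are equivalent if there is an isomorphism $\varphi:E\to E'$ with $\varphi(\gamma)=\gamma'$; here $\operatorname{Aut}(E)=\{\pm1\}$. A stabiliser of $\gamma$ is an element $\alpha\in\mathcal{O}/N\mathcal{O}$ with $(E,\gamma)\sim(E,\alpha(\gamma))$, i.e. $\alpha P=\pm P$; $\operatorname{Stab}(P)$ denotes the set of these. The identification $E[N]\cong\mathcal{O}/N\mathcal{O}$ as $\mathcal{O}/N\mathcal{O}$-modules holds under the stated coprimality hypotheses (after choosing a generator). -}

module Defs where

open import Data.Nat using (ℕ)
import Data.Nat as ℕ
import Data.Nat.Divisibility as ℕD
open import Data.Integer using (ℤ; +_; _+_; _-_; _*_; -_; ∣_∣; _<_)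
open import Data.Integer.Divisibility using (_∣_)
open import Data.Product using (_×_; _,_; proj₁; proj₂; ∃; ∃-syntax)
open import Data.Sum using (_⊎_)
open import Relation.Binary.PropositionalEquality using (_≡_)

-- An imaginary quadratic order is presented as O = ℤ[τ] with τ² = t·τ − n
-- and discriminant D = t² − 4n < 0.  Every order in an imaginary quadratic
-- field has such a ℤ-basis {1, τ}.  Elements a + bτ are pairs (a , b).

disc : ℤ → ℤ → ℤ
disc t n = t * t - (+ 4) * n

Ord : Set
Ord = ℤ × ℤ

module Order (t n : ℤ) where

  infixl 7 _·_
  infixl 6 _⊕_ _⊖_
  infix 4 _≡_[mod_] _∣O_

  _⊕_ : Ord → Ord → Ord
  (a , b) ⊕ (c , d) = (a + c , b + d)

  _⊖_ : Ord → Ord → Ord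
  (a , b) ⊖ (c , d) = (a - c , b - d)

  -- (a + bτ)(c + dτ) = ac − n·bd + (ad + bc + t·bd) τ
  _·_ : Ord → Ord → Ord
  (a , b) · (c , d) = (a * c - n * (b * d) , a * d + b * c + t * (b * d))

  one : Ord
  one = (+ 1 , + 0)

  ι : ℤ → Ord
  ι m = (m , + 0)

  _∣O_ : ℤ → Ord → Set
  m ∣O (a , b) = (m ∣ a) × (m ∣ b)

  _≡_[mod_] : Ord → Ord → ℤ → Set
  x ≡ y [mod m ] = m ∣O (x ⊖ y)

  HasAddOrder : ℕ → Ord → Set
  HasAddOrder N x = ∀ (k : ℕ) → (+ N) ∣O (ι (+ k) · x) → N ℕD.∣ k

  IsUnitMod : ℕ → Ord → Set
  IsUnitMod N α = ∃[ β ] (α · β ≡ one [mod + N ])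

  _∈⟨_,_⟩ : Ord → Ord → ℕ → Set
  x ∈⟨ P , N ⟩ = ∃[ β ] ∃[ γ ] (x ≡ β · P ⊕ γ · ι (+ N))

  -- x = β/m (β ∈ O, m ≥ 1) lies in the fractional ideal 𝔞⁻¹ = {x ∈ K | x𝔞 ⊆ O}
  -- iff β·𝔞 ⊆ m·O.
  InvIdeal : Ord → ℕ → Ord → ℕ → Set
  InvIdeal P N β m = ∀ x → x ∈⟨ P , N ⟩ → (+ m) ∣O (β · x)

  -- y ∈ 𝔞⁻¹·N·O (for y ∈ O) : y = N·x with x = β/m ∈ 𝔞⁻¹,
  -- i.e. m·y = N·β with β·𝔞 ⊆ m·O.
  _∈𝔞⁻¹NO[_,_] : Ord → Ord → ℕ → Set
  y ∈𝔞⁻¹NO[ P , N ] =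
    ∃[ β ] ∃[ m ] (ℕ.NonZero m × (ι (+ m) · y ≡ ι (+ N) · β) × InvIdeal P N β m)

  ≡±1mod𝔞⁻¹NO : Ord → ℕ → Ord → Set
  ≡±1mod𝔞⁻¹NO P N α = ((α ⊖ one) ∈𝔞⁻¹NO[ P , N ]) ⊎ ((α ⊕ one) ∈𝔞⁻¹NO[ P , N ])

  neg : Ord → Ord
  neg (a , b) = (- a , - b)

  Stab : ℕ → Ord → Ord → Set
  Stab N P α = IsUnitMod N α × ((α · P ≡ P [mod + N ]) ⊎ (α · P ≡ neg P [mod + N ]))

SquareFree : ℤ → Set
SquareFree d = ∀ (k : ℕ) → (k ℕ.* k) ℕD.∣ ∣ d ∣ → k ≡ 1

Fundamental : ℤ → Set
Fundamental d =
  (d < + 0) ×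
  ( (((+ 4) ∣ (d - + 1)) × SquareFree d)
  ⊎ (∃[ m ] (d ≡ (+ 4) * m × (((+ 4) ∣ (m - + 2)) ⊎ ((+ 4) ∣ (m - + 3))) × SquareFree m)))

IsConductor : ℤ → ℕ → Set
IsConductor D f = ℕ.NonZero f × ∃[ dK ] (Fundamental dK × D ≡ (+ (f ℕ.* f)) * dK)

-- Both sides share the unit condition, so the content is that for y ∈ O one has N ∣ y·P iff
-- y ∈ 𝔞⁻¹NO, applied to y = α ∓ 1.  If N ∣ yP then y𝔞 ⊆ NO, i.e. y/N ∈ 𝔞⁻¹.  Conversely, if
-- my = Nβ with β𝔞 ⊆ mO, then m·yP = N·βP with m ∣ βP (as P ∈ 𝔞), and cancelling m gives N ∣ yP.
-- The hypotheses on p, the conductor, j(E) and the order of P only serve the identification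
-- E[N] ≅ O/NO, which the statement already presupposes.
module Submission where

open import Defs
open import Data.Nat using (ℕ; _≥_; NonZero)
open import Data.Nat.Primality using (Prime)
open import Data.Nat.Coprimality using (Coprime)
open import Data.Integer using (ℤ; +_; -[1+_]; _<_; _+_; _-_; _*_; -_)
open import Data.Integer.Divisibility using (_∣_)
import Data.Integer.Divisibility.Signed as Signed
open import Data.Integer.Tactic.RingSolver using (solve-∀)
open import Data.Product using (_×_; _,_; proj₁; proj₂; map₂)
import Data.Sum as Sum
open import Function.Bundles using (_⇔_; mk⇔; module Equivalence)
open Equivalence using (to; from)
open import Relation.Binary.PropositionalEquality
  using (_≡_; _≢_; refl; sym; trans; cong; cong₂; subst)
open Relation.Binary.PropositionalEquality.≡-Reasoning

*-cancel-∣ : ∀ m {N c e} .{{_ : NonZero m}} → + m * c ≡ + N * e → + m ∣ e → + N ∣ c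
*-cancel-∣ m {N} {c} {e} mc≡Ne m∣e with Signed.∣ᵤ⇒∣ {+ m} {e} m∣e
... | Signed.divides q refl =
  Signed.∣⇒∣ᵤ {+ N} {c} (Signed.*-cancelˡ-∣ (+ m) (Signed.divides q mc≡q[mN]))
  where
  rotate : ∀ a b c → a * (b * c) ≡ b * (c * a)
  rotate = solve-∀
  mc≡q[mN] : + m * c ≡ q * (+ m * + N)
  mc≡q[mN] = trans mc≡Ne (rotate (+ N) q (+ m))

module OrderProperties (t n : ℤ) where
  open Order t n

  ·-assoc : ∀ x y z → (x · y) · z ≡ x · (y · z)
  ·-assoc (a , b) (c , d) (e , g) = cong₂ _,_ (assoc₁ t n a b c d e g) (assoc₂ t n a b c d e g)
    where
    assoc₁ : ∀ t n a b c d e g →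
      (a * c - n * (b * d)) * e - n * ((a * d + b * c + t * (b * d)) * g)
      ≡ a * (c * e - n * (d * g)) - n * (b * (c * g + d * e + t * (d * g)))
    assoc₁ = solve-∀
    assoc₂ : ∀ t n a b c d e g →
      (a * c - n * (b * d)) * g + (a * d + b * c + t * (b * d)) * e
        + t * ((a * d + b * c + t * (b * d)) * g)
      ≡ a * (c * g + d * e + t * (d * g)) + b * (c * e - n * (d * g))
        + t * (b * (c * g + d * e + t * (d * g)))
    assoc₂ = solve-∀

  ·-comm : ∀ x y → x · y ≡ y · x
  ·-comm (a , b) (c , d) = cong₂ _,_ (comm₁ n a b c d) (comm₂ t a b c d)
    where
    comm₁ : ∀ n a b c d → a * c - n * (b * d) ≡ c * a - n * (d * b)
    comm₁ = solve-∀
    comm₂ : ∀ t a b c d → a * d + b * c + t * (b * d) ≡ c * b + d * a + t * (d * b)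
    comm₂ = solve-∀

  ·-distribˡ-⊕ : ∀ x y z → x · (y ⊕ z) ≡ x · y ⊕ x · z
  ·-distribˡ-⊕ (a , b) (c , d) (e , g) =
    cong₂ _,_ (distrib₁ t n a b c d e g) (distrib₂ t n a b c d e g)
    where
    distrib₁ : ∀ t n a b c d e g →
      a * (c + e) - n * (b * (d + g)) ≡ a * c - n * (b * d) + (a * e - n * (b * g))
    distrib₁ = solve-∀
    distrib₂ : ∀ t n a b c d e g →
      a * (d + g) + b * (c + e) + t * (b * (d + g))
      ≡ a * d + b * c + t * (b * d) + (a * g + b * e + t * (b * g))
    distrib₂ = solve-∀

  ·-swap : ∀ x y z → x · (y · z) ≡ y · (x · z)
  ·-swap x y z = begin
    x · (y · z) ≡⟨ sym (·-assoc x y z) ⟩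
    (x · y) · z ≡⟨ cong (_· z) (·-comm x y) ⟩
    (y · x) · z ≡⟨ ·-assoc y x z ⟩
    y · (x · z) ∎

  ι-· : ∀ m c d → ι m · (c , d) ≡ (m * c , m * d)
  ι-· m c d = cong₂ _,_ (ι-·₁ n m c d) (ι-·₂ t m c d)
    where
    ι-·₁ : ∀ n m c d → m * c - n * (+ 0 * d) ≡ m * c
    ι-·₁ = solve-∀
    ι-·₂ : ∀ t m c d → m * d + + 0 * c + t * (+ 0 * d) ≡ m * d
    ι-·₂ = solve-∀

  [x⊖one]·y : ∀ x y → (x ⊖ one) · y ≡ x · y ⊖ y
  [x⊖one]·y (a , b) (c , d) = cong₂ _,_ (sub₁ n a b c d) (sub₂ t a b c d)
    where
    sub₁ : ∀ n a b c d → (a - + 1) * c - n * ((b - + 0) * d) ≡ a * c - n * (b * d) - c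
    sub₁ = solve-∀
    sub₂ : ∀ t a b c d →
      (a - + 1) * d + (b - + 0) * c + t * ((b - + 0) * d) ≡ a * d + b * c + t * (b * d) - d
    sub₂ = solve-∀

  [x⊕one]·y : ∀ x y → (x ⊕ one) · y ≡ x · y ⊖ neg y
  [x⊕one]·y (a , b) (c , d) = cong₂ _,_ (add₁ n a b c d) (add₂ t a b c d)
    where
    add₁ : ∀ n a b c d → (a + + 1) * c - n * ((b + + 0) * d) ≡ a * c - n * (b * d) - (- c)
    add₁ = solve-∀
    add₂ : ∀ t a b c d →
      (a + + 1) * d + (b + + 0) * c + t * ((b + + 0) * d) ≡ a * d + b * c + t * (b * d) - (- d)
    add₂ = solve-∀

  ∣O-intro : ∀ {m a b} → m Signed.∣ a → m Signed.∣ b → m ∣O (a , b)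
  ∣O-intro m∣a m∣b = Signed.∣⇒∣ᵤ m∣a , Signed.∣⇒∣ᵤ m∣b

  ∣O-⊕ : ∀ m x y → m ∣O x → m ∣O y → m ∣O x ⊕ y
  ∣O-⊕ m (a , b) (c , d) (m∣a , m∣b) (m∣c , m∣d) =
    ∣O-intro (Signed.∣m∣n⇒∣m+n (Signed.∣ᵤ⇒∣ {m} {a} m∣a) (Signed.∣ᵤ⇒∣ {m} {c} m∣c))
             (Signed.∣m∣n⇒∣m+n (Signed.∣ᵤ⇒∣ {m} {b} m∣b) (Signed.∣ᵤ⇒∣ {m} {d} m∣d))

  ∣O-·ˡ : ∀ m x y → m ∣O y → m ∣O x · y
  ∣O-·ˡ m (a , b) (c , d) (m∣c , m∣d) =
    ∣O-intro (Signed.∣m∣n⇒∣m-n (Signed.∣n⇒∣m*n a m∣c′) (Signed.∣n⇒∣m*n n m∣bd))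
             (Signed.∣m∣n⇒∣m+n (Signed.∣m∣n⇒∣m+n (Signed.∣n⇒∣m*n a m∣d′) (Signed.∣n⇒∣m*n b m∣c′))
                               (Signed.∣n⇒∣m*n t m∣bd))
    where
    m∣c′ = Signed.∣ᵤ⇒∣ {m} {c} m∣c
    m∣d′ = Signed.∣ᵤ⇒∣ {m} {d} m∣d
    m∣bd = Signed.∣n⇒∣m*n b m∣d′

  ∣O-ι : ∀ m → m ∣O ι m
  ∣O-ι m = ∣O-intro {m} Signed.∣-refl (Signed.divides (+ 0) refl)

  *-cancel-∣O : ∀ m {N x y} .{{_ : NonZero m}} → ι (+ m) · x ≡ ι (+ N) · y → + m ∣O y → + N ∣O x
  *-cancel-∣O m {N} {c , d} {e , g} mx≡Ny (m∣e , m∣g) =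
    *-cancel-∣ m (cong proj₁ mx≡Ny′) m∣e , *-cancel-∣ m (cong proj₂ mx≡Ny′) m∣g
    where
    mx≡Ny′ : (+ m * c , + m * d) ≡ (+ N * e , + N * g)
    mx≡Ny′ = trans (sym (ι-· (+ m) c d)) (trans mx≡Ny (ι-· (+ N) e g))

  P∈⟨P,N⟩ : ∀ P N → P ∈⟨ P , N ⟩
  P∈⟨P,N⟩ (c , d) N = one , (+ 0 , + 0) , cong₂ _,_ (unit₁ n c d (+ N)) (unit₂ t c d (+ N))
    where
    unit₁ : ∀ n c d k → c ≡ (+ 1 * c - n * (+ 0 * d)) + (+ 0 * k - n * (+ 0 * + 0))
    unit₁ = solve-∀
    unit₂ : ∀ t c d k →
      d ≡ (+ 1 * d + + 0 * c + t * (+ 0 * d)) + (+ 0 * + 0 + + 0 * k + t * (+ 0 * + 0))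
    unit₂ = solve-∀

  ∣O-·⇒InvIdeal : ∀ P N y → + N ∣O y · P → InvIdeal P N y N
  ∣O-·⇒InvIdeal P N y N∣yP x (β , γ , refl) =
    subst (+ N ∣O_) (sym (·-distribˡ-⊕ y (β · P) (γ · ι (+ N))))
      (∣O-⊕ (+ N) (y · (β · P)) (y · (γ · ι (+ N)))
        (subst (+ N ∣O_) (·-swap β y P) (∣O-·ˡ (+ N) β (y · P) N∣yP))
        (∣O-·ˡ (+ N) y (γ · ι (+ N)) (∣O-·ˡ (+ N) γ (ι (+ N)) (∣O-ι (+ N)))))

  ∣O-·⇒∈𝔞⁻¹NO : ∀ P N y → NonZero N → + N ∣O y · P → y ∈𝔞⁻¹NO[ P , N ]
  ∣O-·⇒∈𝔞⁻¹NO P N y N≢0 N∣yP = y , N , N≢0 , refl , ∣O-·⇒InvIdeal P N y N∣yP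

  ∈𝔞⁻¹NO⇒∣O-· : ∀ P N y → y ∈𝔞⁻¹NO[ P , N ] → + N ∣O y · P
  ∈𝔞⁻¹NO⇒∣O-· P N y (β , m , m≢0 , my≡Nβ , β𝔞⊆mO) =
    *-cancel-∣O m {{m≢0}} myP≡NβP (β𝔞⊆mO P (P∈⟨P,N⟩ P N))
    where
    myP≡NβP : ι (+ m) · (y · P) ≡ ι (+ N) · (β · P)
    myP≡NβP = begin
      ι (+ m) · (y · P) ≡⟨ sym (·-assoc (ι (+ m)) y P) ⟩
      (ι (+ m) · y) · P ≡⟨ cong (_· P) my≡Nβ ⟩
      (ι (+ N) · β) · P ≡⟨ ·-assoc (ι (+ N)) β P ⟩
      ι (+ N) · (β · P) ∎

  ∣O-·⇔∈𝔞⁻¹NO : ∀ P N y → NonZero N → (+ N ∣O y · P ⇔ y ∈𝔞⁻¹NO[ P , N ])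
  ∣O-·⇔∈𝔞⁻¹NO P N y N≢0 = mk⇔ (∣O-·⇒∈𝔞⁻¹NO P N y N≢0) (∈𝔞⁻¹NO⇒∣O-· P N y)

  x·P≡P⇔x⊖one∈𝔞⁻¹NO : ∀ P N x → NonZero N →
    x · P ≡ P [mod + N ] ⇔ (x ⊖ one) ∈𝔞⁻¹NO[ P , N ]
  x·P≡P⇔x⊖one∈𝔞⁻¹NO P N x N≢0 =
    subst (λ z → + N ∣O z ⇔ (x ⊖ one) ∈𝔞⁻¹NO[ P , N ])
          ([x⊖one]·y x P) (∣O-·⇔∈𝔞⁻¹NO P N (x ⊖ one) N≢0)

  x·P≡-P⇔x⊕one∈𝔞⁻¹NO : ∀ P N x → NonZero N →
    x · P ≡ neg P [mod + N ] ⇔ (x ⊕ one) ∈𝔞⁻¹NO[ P , N ]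
  x·P≡-P⇔x⊕one∈𝔞⁻¹NO P N x N≢0 =
    subst (λ z → + N ∣O z ⇔ (x ⊕ one) ∈𝔞⁻¹NO[ P , N ])
          ([x⊕one]·y x P) (∣O-·⇔∈𝔞⁻¹NO P N (x ⊕ one) N≢0)

proposition3p4 : (p : ℕ) → Prime p → p ≥ 5 →
    (t n : ℤ) → disc t n < + 0 →
    (f : ℕ) → IsConductor (disc t n) f →
    disc t n ≢ -[1+ 2 ] → disc t n ≢ -[1+ 3 ] →
    (N : ℕ) → NonZero N → Coprime N p → Coprime N f →
    (P : Ord) → Order.HasAddOrder t n N P →
    (α : Ord) →
      Order.Stab t n N P α ⇔ (Order.IsUnitMod t n N α × Order.≡±1mod𝔞⁻¹NO t n P N α)
proposition3p4 _ _ _ t n _ _ _ _ _ N N≢0 _ _ P _ α =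
  mk⇔ (map₂ (Sum.map (to αP≡P⇔) (to αP≡-P⇔)))
      (map₂ (Sum.map (from αP≡P⇔) (from αP≡-P⇔)))
  where
  open Order t n
  open OrderProperties t n
  αP≡P⇔ : α · P ≡ P [mod + N ] ⇔ (α ⊖ one) ∈𝔞⁻¹NO[ P , N ]
  αP≡P⇔ = x·P≡P⇔x⊖one∈𝔞⁻¹NO P N α N≢0
  αP≡-P⇔ : α · P ≡ neg P [mod + N ] ⇔ (α ⊕ one) ∈𝔞⁻¹NO[ P , N ]
  αP≡-P⇔ = x·P≡-P⇔x⊕one∈𝔞⁻¹NO P N α N≢0
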